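{- Let $G=(V,E)$ be a control-flow graph with entry $s$ and terminal $t$ as described in the context, and let $(S,\Psi)$ be a valid coverage instrumentation scheme for $G$. Then every ambiguous node $u\in V$ belongs to $S$.
   Context: $G=(V,E)$ is a finite directed graph with two distinct nodes $s$ (entry) and $t$ (terminal) such that $s$ has in-degree $0$, $t$ has out-degree $0$, every node is reachable from $s$ by a directed path and every node can reach $t$ by a directed path. $N^{in}(u)$, $N^{out}(u)$ are the in- and out-neighbour sets of $u$. An execution trace is a finite collection of (not necessarily simple) directed $s$-$t$ walks; its coverage profile is $C:V\to\{\top,\bot\}$ with $C(u)=\top$ iff $u$ lies on some walk of the trace. $\mathcal C$ is the set of coverage profiles of all execution traces. For $S\subseteq V$, $C_S$ is the restriction of $C$ to $S$. A coverage instrumentation scheme is a pair $(S,\Psi)$ with $S\subseteq V$ and $\Psi$ an efficiently computable function from partial coverage profiles on $S$ to full coverage profiles on $V$; it is valid if $\Psi(C_S)=C$ for every $C\in\mathcal C$. For $u\in V$, $A(u)$ is the set of nodes reachable from $s$ by a directed path avoiding $u$, and $B(u)$ is the set of nodes that can reach $t$ by a directed path avoiding $u$. A node $u$ is ambiguous if there exist $x\in N^{in}(u)\cap A(u)\cap B(u)$ and $y\in N^{out}(u)\cap A(u)\cap B(u)$. -}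

module Defs where

open import Data.Nat using (ℕ)
open import Data.Fin using (Fin)
open import Data.Bool using (Bool; true; false; if_then_else_)
open import Data.Maybe using (Maybe; just; nothing)
open import Data.Vec using (Vec; tabulate; lookup)
open import Data.List using (List; []; _∷_)
open import Data.List.Membership.Propositional using (_∈_; _∉_)
open import Data.List.Relation.Unary.Any using (Any)
open import Data.Product using (Σ; ∃; ∃-syntax; _×_)
open import Data.Empty using (⊥)
open import Relation.Binary.PropositionalEquality using (_≡_; _≢_)
open import Function.Bundles using (_⇔_)

data Walk {n : ℕ} (E : Fin n → Fin n → Set) : Fin n → Fin n → Set where
  stop : (x : Fin n) → Walk E x x
  step : {x y z : Fin n} → E x y → Walk E y z → Walk E x z

nodes : {n : ℕ} {E : Fin n → Fin n → Set} {x y : Fin n} → Walk E x y → List (Fin n)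
nodes (stop x) = x ∷ []
nodes (step {x = x} _ w) = x ∷ nodes w

record CFG (n : ℕ) : Set₁ where
  field
    E        : Fin n → Fin n → Set
    s t      : Fin n
    s≢t      : s ≢ t
    s-no-in  : ∀ x → E x s → ⊥
    t-no-out : ∀ y → E t y → ⊥
    reachS   : ∀ v → Walk E s v
    reachT   : ∀ v → Walk E v t

module _ {n : ℕ} (G : CFG n) where
  open CFG G

  Trace : Set
  Trace = List (Walk E s t)

  Covered : Trace → Fin n → Set
  Covered T v = Any (λ w → v ∈ nodes w) T

  Profile : Set
  Profile = Fin n → Bool

  IsProfileOf : Profile → Trace → Set
  IsProfileOf C T = ∀ v → (C v ≡ true) ⇔ Covered T v

  InCov : Profile → Set
  InCov C = ∃[ T ] IsProfileOf C T

  A : Fin n → Fin n → Set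
  A u v = Σ (Walk E s v) (λ w → u ∉ nodes w)

  B : Fin n → Fin n → Set
  B u v = Σ (Walk E v t) (λ w → u ∉ nodes w)

  Ambiguous : Fin n → Set
  Ambiguous u = (∃[ x ] (E x u × A u x × B u x)) × (∃[ y ] (E u y × A u y × B u y))

-- S ⊆ V is a Vec Bool n (Data.Fin.Subset style: lookup S v ≡ true iff v ∈ S).
-- A partial profile on S is a Vec (Maybe Bool) n with entries nothing outside S.
restrict : {n : ℕ} → Vec Bool n → (Fin n → Bool) → Vec (Maybe Bool) n
restrict S C = tabulate (λ v → if lookup S v then just (C v) else nothing)

Valid : {n : ℕ} (G : CFG n) → Vec Bool n → (Vec (Maybe Bool) n → Fin n → Bool) → Set
Valid G S Ψ = ∀ C → InCov G C → ∀ v → Ψ (restrict S C) v ≡ C v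

{-# OPTIONS --safe #-}
-- If u ∉ S, two traces whose coverage differs only at u have the same
-- restriction to S, so Ψ cannot recover both. An ambiguous u supplies them:
-- with x → u → y and u-avoiding walks s ⇝ x ⇝ t and s ⇝ y ⇝ t, the walks
-- s ⇝ x ⇝ t and s ⇝ y ⇝ t cover everything s ⇝ x → u → y ⇝ t covers except u.
module Submission where

open import Defs
open import Data.Nat using (ℕ)
open import Data.Fin using (Fin; _≟_)
open import Data.Fin.Subset using (Subset; _∈_)
open import Data.Fin.Subset.Properties using (_∈?_)
open import Data.Bool using (Bool; true; false; if_then_else_)
open import Data.Maybe using (Maybe; just; nothing)
open import Data.Vec using (Vec; lookup)
open import Data.Vec.Properties using (tabulate-cong; lookup⇒[]=)
open import Data.List using ([]; _∷_)
import Data.List.Membership.Propositional as List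
open import Data.List.Relation.Unary.Any using (here; there; any?)
open import Data.Product using (∃₂; _×_; _,_)
open import Data.Sum using (_⊎_; inj₁; inj₂; [_,_]; map₁)
open import Relation.Nullary using (Dec; yes; no; does; ¬_; contradiction)
open import Relation.Nullary.Decidable using (dec-true; dec-false; does-⇔)
open import Relation.Binary.PropositionalEquality using (_≡_; _≢_; refl; cong; module ≡-Reasoning)
open import Function.Bundles using (_⇔_; mk⇔)

module _ {n : ℕ} {E : Fin n → Fin n → Set} where

  _++ʷ_ : {x y z : Fin n} → Walk E x y → Walk E y z → Walk E x z
  stop _   ++ʷ q = q
  step e p ++ʷ q = step e (p ++ʷ q)

  source∈nodes : {x y : Fin n} (p : Walk E x y) → x List.∈ nodes p
  source∈nodes (stop _)   = here refl
  source∈nodes (step _ _) = here refl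

  ∈-++ʷ⁻ : {x y z v : Fin n} (p : Walk E x y) (q : Walk E y z) →
    v List.∈ nodes (p ++ʷ q) → v List.∈ nodes p ⊎ v List.∈ nodes q
  ∈-++ʷ⁻ (stop _)   q v∈q         = inj₂ v∈q
  ∈-++ʷ⁻ (step _ p) q (here refl) = inj₁ (here refl)
  ∈-++ʷ⁻ (step _ p) q (there v∈)  = map₁ there (∈-++ʷ⁻ p q v∈)

  ∈-++ʷ⁺ˡ : {x y z v : Fin n} (p : Walk E x y) (q : Walk E y z) →
    v List.∈ nodes p → v List.∈ nodes (p ++ʷ q)
  ∈-++ʷ⁺ˡ (stop _)   q (here refl) = source∈nodes q
  ∈-++ʷ⁺ˡ (step _ p) q (here refl) = here refl
  ∈-++ʷ⁺ˡ (step _ p) q (there v∈p) = there (∈-++ʷ⁺ˡ p q v∈p)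

  ∈-++ʷ⁺ʳ : {x y z v : Fin n} (p : Walk E x y) (q : Walk E y z) →
    v List.∈ nodes q → v List.∈ nodes (p ++ʷ q)
  ∈-++ʷ⁺ʳ (stop _)   q v∈q = v∈q
  ∈-++ʷ⁺ʳ (step _ p) q v∈q = there (∈-++ʷ⁺ʳ p q v∈q)

  ∉-++ʷ : {x y z v : Fin n} (p : Walk E x y) (q : Walk E y z) →
    v List.∉ nodes p → v List.∉ nodes q → v List.∉ nodes (p ++ʷ q)
  ∉-++ʷ p q v∉p v∉q v∈ = [ v∉p , v∉q ] (∈-++ʷ⁻ p q v∈)

does≡true⇔ : {A : Set} (a? : Dec A) → does a? ≡ true ⇔ A
does≡true⇔ (yes a) = mk⇔ (λ _ → a) (λ _ → refl)
does≡true⇔ (no ¬a) = mk⇔ (λ ()) (λ a → contradiction a ¬a)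

module _ {n : ℕ} (G : CFG n) where
  open CFG G

  covered? : (T : Trace G) (v : Fin n) → Dec (Covered G T v)
  covered? T v = any? (λ w → v ∈ₗ? nodes w) T
    where open import Data.List.Membership.DecPropositional (_≟_ {n}) using () renaming (_∈?_ to _∈ₗ?_)

  profile : Trace G → Profile G
  profile T v = does (covered? T v)

  profile∈𝒞 : (T : Trace G) → InCov G (profile T)
  profile∈𝒞 T = T , λ v → does≡true⇔ (covered? T v)

  ambiguous⇒twinTraces : {u : Fin n} → Ambiguous G u →
    ∃₂ λ (T₁ T₂ : Trace G) → Covered G T₁ u × ¬ Covered G T₂ u ×
      (∀ v → v ≢ u → Covered G T₁ v ⇔ Covered G T₂ v)
  ambiguous⇒twinTraces {u} ((x , x→u , (sx , u∉sx) , (xt , u∉xt)) ,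
                            (y , u→y , (sy , u∉sy) , (yt , u∉yt)))
    = T₁ , T₂ , here (∈-++ʷ⁺ʳ sx _ (there (here refl))) , u∉T₂
    , λ v v≢u → mk⇔ (detour⊆T₂ v v≢u) there
    where
    detour : Walk E s t
    detour = sx ++ʷ step x→u (step u→y yt)
    T₂ T₁ : Trace G
    T₂ = (sx ++ʷ xt) ∷ (sy ++ʷ yt) ∷ []
    T₁ = detour ∷ T₂

    u∉T₂ : ¬ Covered G T₂ u
    u∉T₂ (here u∈)         = ∉-++ʷ sx xt u∉sx u∉xt u∈
    u∉T₂ (there (here u∈)) = ∉-++ʷ sy yt u∉sy u∉yt u∈

    detour⊆T₂ : ∀ v → v ≢ u → Covered G T₁ v → Covered G T₂ v
    detour⊆T₂ v v≢u (there v∈T₂) = v∈T₂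
    detour⊆T₂ v v≢u (here v∈) with ∈-++ʷ⁻ sx _ v∈
    ... | inj₁ v∈sx                 = here (∈-++ʷ⁺ˡ sx xt v∈sx)
    ... | inj₂ (here refl)          = here (∈-++ʷ⁺ʳ sx xt (source∈nodes xt))
    ... | inj₂ (there (here refl))  = contradiction refl v≢u
    ... | inj₂ (there (there v∈yt)) = there (here (∈-++ʷ⁺ʳ sy yt v∈yt))

restrict-cong : {n : ℕ} (S : Subset n) {C C′ : Fin n → Bool} →
  (∀ v → v ∈ S → C v ≡ C′ v) → restrict S C ≡ restrict S C′
restrict-cong S {C} {C′} C≡C′ = tabulate-cong agree
  where
  agree : ∀ v → (if lookup S v then just (C v) else nothing)
              ≡ (if lookup S v then just (C′ v) else nothing)
  agree v with lookup S v in eq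
  ... | true  = cong just (C≡C′ v (lookup⇒[]= v S eq))
  ... | false = refl

valid⇒determinedBy : {n : ℕ} (G : CFG n) (S : Subset n) (Ψ : Vec (Maybe Bool) n → Fin n → Bool) →
  Valid G S Ψ → {C C′ : Profile G} → InCov G C → InCov G C′ →
  (∀ v → v ∈ S → C v ≡ C′ v) → ∀ v → C v ≡ C′ v
valid⇒determinedBy G S Ψ valid {C} {C′} C∈𝒞 C′∈𝒞 C≡C′ v = begin
  C v                   ≡⟨ valid C C∈𝒞 v ⟨
  Ψ (restrict S C) v    ≡⟨ cong (λ R → Ψ R v) (restrict-cong S C≡C′) ⟩
  Ψ (restrict S C′) v   ≡⟨ valid C′ C′∈𝒞 v ⟩
  C′ v                  ∎
  where open ≡-Reasoning

lemma2 : {n : ℕ} (G : CFG n) (S : Subset n) (Ψ : Vec (Maybe Bool) n → Fin n → Bool) →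
    Valid G S Ψ → (u : Fin n) → Ambiguous G u → u ∈ S
lemma2 G S Ψ valid u ambiguous with u ∈? S | ambiguous⇒twinTraces G ambiguous
... | yes u∈S | _ = u∈S
... | no  u∉S | T₁ , T₂ , u∈T₁ , u∉T₂ , sameOff-u = contradiction true≡false λ ()
  where
  sameOnS : ∀ v → v ∈ S → profile G T₁ v ≡ profile G T₂ v
  sameOnS v v∈S = does-⇔ (sameOff-u v λ { refl → u∉S v∈S }) (covered? G T₁ v) (covered? G T₂ v)

  true≡false : true ≡ false
  true≡false = begin
    true             ≡⟨ dec-true (covered? G T₁ u) u∈T₁ ⟨
    profile G T₁ u   ≡⟨ valid⇒determinedBy G S Ψ valid (profile∈𝒞 G T₁) (profile∈𝒞 G T₂) sameOnS u ⟩
    profile G T₂ u   ≡⟨ dec-false (covered? G T₂ u) u∉T₂ ⟩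
    false            ∎
    where open ≡-Reasoning
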